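{- Let $G=(V,E)$ be a finite simple graph with $\gamma(G)=k$, let $v\in V$, and let $X$ be a finite set of new vertices with $V\cap X=\emptyset$. Let $G'$ be any graph with vertex set $V\cup X$ whose induced subgraph on $V$ is $G$ and in which the vertices of $\{v\}\cup X$ are pairwise false twins, or pairwise true twins. Then $\gamma(G')\le k+1$.
   Context: All graphs are finite, simple and undirected. $N(u)$ denotes the neighbourhood of $u$. Distinct vertices $u,v$ are true twins if $N(u)\cup\{u\}=N(v)\cup\{v\}$ and false twins if $N(u)=N(v)$. A graph $G=(V,E)$ is a star-$k$-PCG if there exist a weight function $w:V\to\mathbb{R}^+$ and $k$ pairwise disjoint intervals $I_1,\dots,I_k$ such that for distinct $u,v\in V$, $uv\in E$ if and only if $w(u)+w(v)\in\bigcup_i I_i$. The star number $\gamma(G)$ is the least positive integer $k$ such that $G$ is a star-$k$-PCG.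
   Formalization: The weight function and the interval endpoints in the definition of a star-$k$-PCG, and hence of the star number $\gamma(G)$, are rational rather than real. -}

module Defs where

open import Data.Bool using (Bool; true; false)
open import Data.Nat using (ℕ; zero; suc; _+_; _≤_)
open import Data.Fin using (Fin; _↑ˡ_; _↑ʳ_)
open import Data.Maybe using (Maybe; just; nothing)
open import Data.Product using (Σ; ∃; _×_; _,_)
open import Data.Sum using (_⊎_)
open import Data.Unit using (⊤)
open import Data.Empty using (⊥)
open import Relation.Nullary using (¬_)
open import Relation.Binary.PropositionalEquality using (_≡_; _≢_)
open import Function.Bundles using (_⇔_)
open import Data.Rational as ℚ using (ℚ; 0ℚ) renaming (_+_ to _+ℚ_; _<_ to _<ℚ_; _≤_ to _≤ℚ_)

record Graph (n : ℕ) : Set where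
  field
    adj   : Fin n → Fin n → Bool
    sym   : ∀ u v → adj u v ≡ adj v u
    irrefl : ∀ u → adj u u ≡ false
open Graph public

-- An endpoint of an interval: nothing = unbounded, just (a , true) = closed at a,
-- just (a , false) = open at a.
Endpoint : Set
Endpoint = Maybe (ℚ × Bool)

record Interval : Set where
  constructor interval
  field
    lower : Endpoint
    upper : Endpoint
open Interval public

AboveLower : Endpoint → ℚ → Set
AboveLower nothing          x = ⊤
AboveLower (just (a , true))  x = a ≤ℚ x
AboveLower (just (a , false)) x = a <ℚ x

BelowUpper : Endpoint → ℚ → Set
BelowUpper nothing          x = ⊤
BelowUpper (just (b , true))  x = x ≤ℚ b
BelowUpper (just (b , false)) x = x <ℚ b

_∈I_ : ℚ → Interval → Set
x ∈I I = AboveLower (lower I) x × BelowUpper (upper I) x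

IsStarPCG : ∀ {n} → Graph n → ℕ → Set
IsStarPCG {n} G k =
  Σ (Fin n → ℚ) λ w → Σ (Fin k → Interval) λ I →
    (∀ u → 0ℚ <ℚ w u)
  × (∀ i j → i ≢ j → ∀ x → ¬ (x ∈I I i × x ∈I I j))
  × (∀ u v → u ≢ v → (adj G u v ≡ true ⇔ ∃ λ i → (w u +ℚ w v) ∈I I i))

StarNumberIs : ∀ {n} → Graph n → ℕ → Set
StarNumberIs G k = 1 ≤ k × IsStarPCG G k × (∀ j → 1 ≤ j → suc j ≤ k → ¬ IsStarPCG G j)

StarNumberAtMost : ∀ {n} → Graph n → ℕ → Set
StarNumberAtMost G m = ∃ λ j → 1 ≤ j × j ≤ m × IsStarPCG G j

InducedOnOld : ∀ {n m} → Graph (n + m) → Graph n → Set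
InducedOnOld {n} {m} G' G = ∀ u v → adj G' (u ↑ˡ m) (v ↑ˡ m) ≡ adj G u v

FalseTwins : ∀ {N} → Graph N → Fin N → Fin N → Set
FalseTwins G u v = ∀ x → adj G u x ≡ adj G v x

TrueTwins : ∀ {N} → Graph N → Fin N → Fin N → Set
TrueTwins G u v = ∀ x → (x ≡ u ⊎ adj G u x ≡ true) ⇔ (x ≡ v ⊎ adj G v x ≡ true)

InVX : ∀ {n m} → Fin n → Fin (n + m) → Set
InVX {n} {m} v u = u ≡ v ↑ˡ m ⊎ ∃ λ (x : Fin m) → u ≡ n ↑ʳ x

PairwiseOn : ∀ {N} → (Fin N → Set) → (Fin N → Fin N → Set) → Set
PairwiseOn S R = ∀ u u' → S u → S u' → u ≢ u' → R u u'

{-# OPTIONS --safe #-}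
module Submission where

-- Clearing denominators turns a star-k-PCG representation of G into one with positive integer
-- weights w and closed integer ranges.  Give every old vertex u ≠ v the weight 3 w(u), and v
-- and all new vertices the weight 3 w(v) + 1.  A pair involving an old vertex u ≠ v then sums
-- to 3 s + e with e ∈ {0, 1}, where s is the sum of the corresponding pair in G, and the range
-- [3 a, 3 b + 1] contains 3 s + e exactly when [a, b] contains s.  Two vertices of {v} ∪ X sum
-- to 6 w(v) + 2 ≡ 2 (mod 3), a point no other pair hits, so one more range can put it in (a
-- singleton, for true twins) or take it out (splitting the range containing it, for false twins).

open import Defs hiding (sym)
open import Data.Nat using (ℕ; suc)
open import Data.Fin using (Fin)
open import Data.Sum using (_⊎_)

import Data.Nat as ℕ
import Data.Nat.Properties as ℕ
open import Data.Integer as ℤ using (ℤ; +_; +[1+_]; -_; _+_; _*_; _≤_; _<_; pred)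
import Data.Integer.Properties as ℤ
open import Data.Integer.DivMod using (_/ℕ_; _%ℕ_; a≡a%ℕn+[a/ℕn]*n; n%ℕd<d; n<s[n/ℕd]*d)
open import Data.Integer.Tactic.RingSolver using (solve-∀)
open import Algebra.Properties.AbelianGroup ℤ.+-0-abelianGroup using (∙-cancelˡ)
open import Data.Rational as ℚ using (ℚ; 0ℚ; ↥_; ↧_; ↧ₙ_; toℚᵘ; fromℚᵘ)
import Data.Rational.Properties as ℚ
open import Data.Rational.Unnormalised as ℚᵘ using (mkℚᵘ; *≤*; *≡*) renaming (↥_ to ↥ᵘ_; ↧_ to ↧ᵘ_)
import Data.Rational.Unnormalised.Properties as ℚᵘ
open import Data.Bool using (Bool; true; false)
open import Data.Empty using (⊥; ⊥-elim)
open import Data.Unit using (tt)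
open import Data.Maybe as Maybe using (Maybe; just; nothing)
open import Data.Maybe.Relation.Unary.All as All using (All; just; nothing)
import Data.Maybe.Relation.Unary.All.Properties as All
open import Data.Fin using (zero; suc; _↑ˡ_; splitAt)
import Data.Fin.Properties as Fin
open import Data.Vec.Functional using (_∷_; updateAt)
open import Data.Vec.Functional.Properties using (updateAt-updates; updateAt-minimal)
open import Data.Product using (∃; ∃₂; _×_; _,_; proj₂; map₂)
open import Data.Product.Function.NonDependent.Propositional using (_×-⇔_)
open import Data.Product.Function.Dependent.Propositional using (congˡ)
open import Data.Sum using (inj₁; inj₂; fromInj₂)
open import Function using (_∘_; const)
open import Function.Bundles using (_⇔_; mk⇔; Equivalence)
open import Function.Construct.Composition using (_⇔-∘_)
open import Function.Construct.Symmetry using (⇔-sym)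
open import Function.Properties.Equivalence using (⇔-setoid)
open import Function.Related.Propositional using (equivalence)
open import Level using (0ℓ)
open import Relation.Binary.Definitions using (tri<; tri≈; tri>)
open import Relation.Binary.PropositionalEquality
  using (_≡_; _≢_; refl; sym; trans; cong; cong₂; subst; subst₂; module ≡-Reasoning)
import Relation.Binary.Reasoning.Setoid as SetoidReasoning
open import Relation.Nullary using (¬_; Dec; yes; no; contradiction)
open import Relation.Nullary.Decidable using (_×-dec_)

open Equivalence using (to; from)

module ⇔-Reasoning = SetoidReasoning (⇔-setoid 0ℓ)

i<suc[j]⇒i≤j : ∀ {i j} → i < ℤ.suc j → i ≤ j
i<suc[j]⇒i≤j {i} {j} i<j+1 = subst (i ≤_) (ℤ.pred-suc j) (ℤ.i<j⇒i≤pred[j] i<j+1)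

*-cancelˡ-≤-+ : ∀ c {x y s} → s ℕ.< c → + c * x ≤ + c * y + + s → x ≤ y
*-cancelˡ-≤-+ c {x} {y} {s} s<c cx≤cy+s = i<suc[j]⇒i≤j (ℤ.*-cancelˡ-<-nonNeg (+ c) (begin-strict
  + c * x        ≤⟨ cx≤cy+s ⟩
  + c * y + + s  <⟨ ℤ.+-monoʳ-< (+ c * y) (ℤ.+<+ s<c) ⟩
  + c * y + + c  ≡⟨ ℤ.+-comm (+ c * y) (+ c) ⟩
  + c + + c * y  ≡⟨ ℤ.*-suc (+ c) y ⟨
  + c * ℤ.suc y  ∎))
  where open ℤ.≤-Reasoning

*-+-residue-injective : ∀ c {x y e f} → e ℕ.< c → f ℕ.< c →
                        + c * x + + e ≡ + c * y + + f → e ≡ f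
*-+-residue-injective c {x} {y} {e} {f} e<c f<c eq =
  ℤ.+-injective (∙-cancelˡ (+ c * x) (+ e) (+ f) (trans eq (cong (λ z → + c * z + + f) (sym x≡y))))
  where
  x≡y : x ≡ y
  x≡y = ℤ.≤-antisym
    (*-cancelˡ-≤-+ c f<c (ℤ.≤-trans (ℤ.i≤i+j (+ c * x) (+ e)) (ℤ.≤-reflexive eq)))
    (*-cancelˡ-≤-+ c e<c (ℤ.≤-trans (ℤ.i≤i+j (+ c * y) (+ f)) (ℤ.≤-reflexive (sym eq))))

divMod3 : ∀ z → ∃₂ λ q e → e ℕ.< 3 × z ≡ + 3 * q + + e
divMod3 z = z /ℕ 3 , z %ℕ 3 , n%ℕd<d z 3 , (begin
  z                           ≡⟨ a≡a%ℕn+[a/ℕn]*n z 3 ⟩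
  + (z %ℕ 3) + z /ℕ 3 * + 3   ≡⟨ ℤ.+-comm (+ (z %ℕ 3)) (z /ℕ 3 * + 3) ⟩
  z /ℕ 3 * + 3 + + (z %ℕ 3)   ≡⟨ cong (_+ + (z %ℕ 3)) (ℤ.*-comm (z /ℕ 3) (+ 3)) ⟩
  + 3 * (z /ℕ 3) + + (z %ℕ 3) ∎)
  where open ≡-Reasoning

*-≤⇔≤-/ℕ : ∀ t m q .{{_ : ℕ.NonZero q}} → t * + q ≤ m ⇔ t ≤ m /ℕ q
*-≤⇔≤-/ℕ t m q = mk⇔
  (λ tq≤m → i<suc[j]⇒i≤j (ℤ.*-cancelʳ-<-nonNeg (+ q) (ℤ.≤-<-trans tq≤m (n<s[n/ℕd]*d m q))))
  (λ t≤m/q → begin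
    t * + q                    ≤⟨ ℤ.*-monoʳ-≤-nonNeg (+ q) t≤m/q ⟩
    m /ℕ q * + q               ≤⟨ ℤ.i≤j+i (m /ℕ q * + q) (+ (m %ℕ q)) ⟩
    + (m %ℕ q) + m /ℕ q * + q  ≡⟨ a≡a%ℕn+[a/ℕn]*n m q ⟨
    m                          ∎)
  where open ℤ.≤-Reasoning

⌈_/ℕ_⌉ : ℤ → (q : ℕ) .{{_ : ℕ.NonZero q}} → ℤ
⌈ m /ℕ q ⌉ = - ((- m) /ℕ q)

neg-≤⇔ : ∀ {i j} → i ≤ j ⇔ - j ≤ - i
neg-≤⇔ = mk⇔ ℤ.neg-mono-≤ ℤ.neg-cancel-≤

≤-*⇔⌈/ℕ⌉-≤ : ∀ t m q .{{_ : ℕ.NonZero q}} → m ≤ t * + q ⇔ ⌈ m /ℕ q ⌉ ≤ t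
≤-*⇔⌈/ℕ⌉-≤ t m q = begin
  m ≤ t * + q            ≈⟨ neg-≤⇔ ⟩
  - (t * + q) ≤ - m      ≡⟨ cong (_≤ - m) (ℤ.neg-distribˡ-* t (+ q)) ⟩
  (- t) * + q ≤ - m      ≈⟨ *-≤⇔≤-/ℕ (- t) (- m) q ⟩
  - t ≤ (- m) /ℕ q       ≈⟨ neg-≤⇔ ⟩
  ⌈ m /ℕ q ⌉ ≤ - - t     ≡⟨ cong (⌈ m /ℕ q ⌉ ≤_) (ℤ.neg-involutive t) ⟩
  ⌈ m /ℕ q ⌉ ≤ t         ∎
  where open ⇔-Reasoning

-- Integer ranges

record Range : Set where
  constructor _⋯_
  field
    lo hi : Maybe ℤ

_∈ᴿ_ : ℤ → Range → Set
t ∈ᴿ (a ⋯ b) = All (_≤ t) a × All (t ≤_) b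

_∈ᴿ?_ : ∀ t r → Dec (t ∈ᴿ r)
t ∈ᴿ? (a ⋯ b) = All.dec (ℤ._≤? t) a ×-dec All.dec (t ℤ.≤?_) b

∅ᴿ : Range
∅ᴿ = just (+ 1) ⋯ just (+ 0)

∉∅ᴿ : ∀ t → ¬ t ∈ᴿ ∅ᴿ
∉∅ᴿ t (just 1≤t , just t≤0) with ℤ.≤-trans 1≤t t≤0
... | ℤ.+≤+ ()

[_]ᴿ : ℤ → Range
[ z ]ᴿ = just z ⋯ just z

∈[]ᴿ : ∀ {t z} → t ∈ᴿ [ z ]ᴿ ⇔ t ≡ z
∈[]ᴿ = mk⇔ (λ { (just z≤t , just t≤z) → ℤ.≤-antisym t≤z z≤t })
           (λ { refl → just ℤ.≤-refl , just ℤ.≤-refl })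

Covered : ∀ {k} → (Fin k → Range) → ℤ → Set
Covered R t = ∃ λ i → t ∈ᴿ R i

Disjoint : ∀ {k} → (Fin k → Range) → Set
Disjoint R = ∀ i j → i ≢ j → ∀ t → t ∈ᴿ R i → t ∈ᴿ R j → ⊥

module _ {k : ℕ} {R : Fin k → Range} where

  Covered-∷ : ∀ {r t} → Covered (r ∷ R) t ⇔ (t ∈ᴿ r ⊎ Covered R t)
  Covered-∷ = ⇔-sym Fin.⊎⇔∃

  Covered-∷-∉ : ∀ {r t} → ¬ t ∈ᴿ r → Covered (r ∷ R) t ⇔ Covered R t
  Covered-∷-∉ t∉r = mk⇔ (fromInj₂ (⊥-elim ∘ t∉r) ∘ to Covered-∷) (from Covered-∷ ∘ inj₂)

  Disjoint-∷ : ∀ {r} → Disjoint R → (∀ i t → t ∈ᴿ r → t ∈ᴿ R i → ⊥) → Disjoint (r ∷ R)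
  Disjoint-∷ _  _  zero    zero    0≢0 = contradiction refl 0≢0
  Disjoint-∷ _  dr zero    (suc j) _   t t∈r t∈j = dr j t t∈r t∈j
  Disjoint-∷ _  dr (suc i) zero    _   t t∈i t∈r = dr i t t∈r t∈i
  Disjoint-∷ dR _  (suc i) (suc j) i≢j = dR i j (i≢j ∘ cong suc)

  Disjoint-⊆ : ∀ {R′ : Fin k → Range} → (∀ i {t} → t ∈ᴿ R′ i → t ∈ᴿ R i) → Disjoint R → Disjoint R′
  Disjoint-⊆ R′⊆R dR i j i≢j t t∈i t∈j = dR i j i≢j t (R′⊆R i t∈i) (R′⊆R j t∈j)

triple : Range → Range
triple (a ⋯ b) = Maybe.map (+ 3 *_) a ⋯ Maybe.map (λ y → + 3 * y + + 1) b

triple⁺ : ∀ {r t e} → e ℕ.≤ 1 → t ∈ᴿ r → (+ 3 * t + + e) ∈ᴿ triple r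
triple⁺ {t = t} {e} e≤1 (a≤t , t≤b) =
  All.map⁺ (All.map (λ a≤t → ℤ.≤-trans (ℤ.*-monoˡ-≤-nonNeg (+ 3) a≤t) (ℤ.i≤i+j (+ 3 * t) (+ e))) a≤t) ,
  All.map⁺ (All.map (λ t≤b → ℤ.+-mono-≤ (ℤ.*-monoˡ-≤-nonNeg (+ 3) t≤b) (ℤ.+≤+ e≤1)) t≤b)

triple⁻ : ∀ {r t e} → e ℕ.< 3 → (+ 3 * t + + e) ∈ᴿ triple r → t ∈ᴿ r
triple⁻ {t = t} {e} e<3 (3a≤ , ≤3b+1) =
  All.map (*-cancelˡ-≤-+ 3 e<3) (All.map⁻ 3a≤) ,
  All.map (λ le → *-cancelˡ-≤-+ 3 (ℕ.s≤s (ℕ.s≤s ℕ.z≤n)) (ℤ.≤-trans (ℤ.i≤i+j (+ 3 * t) (+ e)) le))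
          (All.map⁻ ≤3b+1)

module _ {k : ℕ} {R : Fin k → Range} where

  Disjoint-triple : Disjoint R → Disjoint (triple ∘ R)
  Disjoint-triple dR i j i≢j z z∈i z∈j with divMod3 z
  ... | q , e , e<3 , refl = dR i j i≢j q (triple⁻ e<3 z∈i) (triple⁻ e<3 z∈j)

  Covered-triple : ∀ {t e} → e ℕ.≤ 1 → Covered (triple ∘ R) (+ 3 * t + + e) ⇔ Covered R t
  Covered-triple e≤1 = mk⇔ (map₂ (triple⁻ (ℕ.s≤s (ℕ.m≤n⇒m≤1+n e≤1)))) (map₂ (triple⁺ e≤1))

cutBelow cutAbove : ℤ → Range → Range
cutBelow z (a ⋯ _) = a ⋯ just (pred z)
cutAbove z (_ ⋯ b) = just (ℤ.suc z) ⋯ b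

module _ (z : ℤ) {r : Range} where

  cutBelow-< : ∀ {t} → t ∈ᴿ cutBelow z r → t < z
  cutBelow-< (_ , just t≤z-1) = ℤ.i≤pred[j]⇒i<j t≤z-1

  cutAbove-> : ∀ {t} → t ∈ᴿ cutAbove z r → z < t
  cutAbove-> (just z+1≤t , _) = ℤ.suc[i]≤j⇒i<j z+1≤t

  cutBelow-⊆ : ∀ {t} → z ∈ᴿ r → t ∈ᴿ cutBelow z r → t ∈ᴿ r
  cutBelow-⊆ (_ , z≤b) t∈@(a≤t , _) = a≤t , All.map (ℤ.≤-trans (ℤ.<⇒≤ (cutBelow-< t∈))) z≤b

  cutAbove-⊆ : ∀ {t} → z ∈ᴿ r → t ∈ᴿ cutAbove z r → t ∈ᴿ r
  cutAbove-⊆ (a≤z , _) t∈@(_ , t≤b) = All.map (λ a≤z → ℤ.≤-trans a≤z (ℤ.<⇒≤ (cutAbove-> t∈))) a≤z , t≤b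

  cut⁺ : ∀ {t} → t ∈ᴿ r → t ≢ z → t ∈ᴿ cutBelow z r ⊎ t ∈ᴿ cutAbove z r
  cut⁺ {t} (a≤t , t≤b) t≢z with ℤ.<-cmp t z
  ... | tri< t<z _ _ = inj₁ (a≤t , just (ℤ.i<j⇒i≤pred[j] t<z))
  ... | tri≈ _ t≡z _ = contradiction t≡z t≢z
  ... | tri> _ _ z<t = inj₂ (just (ℤ.i<j⇒suc[i]≤j z<t) , t≤b)

record Toggled {k} (R : Fin k → Range) (z : ℤ) (b : Bool) : Set where
  field
    ranges    : Fin (suc k) → Range
    disjoint  : Disjoint ranges
    elsewhere : ∀ {t} → t ≢ z → Covered ranges t ⇔ Covered R t
    at        : Covered ranges z ⇔ b ≡ true

module _ {k : ℕ} {R : Fin k → Range} (dR : Disjoint R) where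

  private
    pad : ∀ {z b} → (Covered R z ⇔ b ≡ true) → Toggled R z b
    pad {z} z∈R⇔b = record
      { ranges    = ∅ᴿ ∷ R
      ; disjoint  = Disjoint-∷ dR (λ _ t t∈∅ _ → ∉∅ᴿ t t∈∅)
      ; elsewhere = λ {t} _ → Covered-∷-∉ (∉∅ᴿ t)
      ; at        = z∈R⇔b ⇔-∘ Covered-∷-∉ (∉∅ᴿ z)
      }

    insert : ∀ {z} → ¬ Covered R z → Toggled R z true
    insert {z} z∉R = record
      { ranges    = [ z ]ᴿ ∷ R
      ; disjoint  = Disjoint-∷ dR (λ i t t∈z t∈i → z∉R (i , subst (_∈ᴿ R i) (to ∈[]ᴿ t∈z) t∈i))
      ; elsewhere = λ t≢z → Covered-∷-∉ (t≢z ∘ to ∈[]ᴿ)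
      ; at        = mk⇔ (const refl) (const (zero , from ∈[]ᴿ refl))
      }

    module Split {z i} (z∈i : z ∈ᴿ R i) where

      below : Fin k → Range
      below = updateAt R i (cutBelow z)

      above : Range
      above = cutAbove z (R i)

      below-at : ∀ {t} → t ∈ᴿ below i ⇔ t ∈ᴿ cutBelow z (R i)
      below-at {t} = mk⇔ (subst (t ∈ᴿ_) (updateAt-updates i R)) (subst (t ∈ᴿ_) (sym (updateAt-updates i R)))

      below-off : ∀ {j t} → j ≢ i → t ∈ᴿ below j ⇔ t ∈ᴿ R j
      below-off {j} {t} j≢i =
        mk⇔ (subst (t ∈ᴿ_) (updateAt-minimal j i R j≢i)) (subst (t ∈ᴿ_) (sym (updateAt-minimal j i R j≢i)))

      below⊆R : ∀ j {t} → t ∈ᴿ below j → t ∈ᴿ R j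
      below⊆R j with j Fin.≟ i
      ... | yes refl = cutBelow-⊆ z z∈i ∘ to below-at
      ... | no j≢i   = to (below-off j≢i)

      above-apart : ∀ j t → t ∈ᴿ above → t ∈ᴿ below j → ⊥
      above-apart j t t∈above t∈j with j Fin.≟ i
      ... | yes refl = ℤ.<-asym (cutBelow-< z {R i} (to below-at t∈j)) (cutAbove-> z {R i} t∈above)
      ... | no j≢i   = dR i j (j≢i ∘ sym) t (cutAbove-⊆ z z∈i t∈above) (to (below-off j≢i) t∈j)

      shrink : ∀ {t} → Covered (above ∷ below) t → Covered R t
      shrink (zero  , t∈above) = i , cutAbove-⊆ z z∈i t∈above
      shrink (suc j , t∈j)     = j , below⊆R j t∈j

      enlarge : ∀ {t} → t ≢ z → Covered R t → Covered (above ∷ below) t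
      enlarge t≢z (j , t∈j) with j Fin.≟ i
      ... | no j≢i   = suc j , from (below-off j≢i) t∈j
      ... | yes refl with cut⁺ z t∈j t≢z
      ...   | inj₁ t∈below = suc i , from below-at t∈below
      ...   | inj₂ t∈above = zero , t∈above

      z∉ : ¬ Covered (above ∷ below) z
      z∉ (zero  , z∈above) = ℤ.<-irrefl refl (cutAbove-> z {R i} z∈above)
      z∉ (suc j , z∈j) with j Fin.≟ i
      ... | yes refl = ℤ.<-irrefl refl (cutBelow-< z {R i} (to below-at z∈j))
      ... | no j≢i   = dR j i j≢i z (to (below-off j≢i) z∈j) z∈i

    delete : ∀ {z i} → z ∈ᴿ R i → Toggled R z false
    delete z∈i = record
      { ranges    = above ∷ below
      ; disjoint  = Disjoint-∷ (Disjoint-⊆ below⊆R dR) above-apart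
      ; elsewhere = λ t≢z → mk⇔ shrink (enlarge t≢z)
      ; at        = mk⇔ (⊥-elim ∘ z∉) λ ()
      }
      where open Split z∈i

  toggle : ∀ z b → Toggled R z b
  toggle z b with Fin.any? (λ i → z ∈ᴿ? R i) | b
  ... | yes z∈R       | true  = pad (mk⇔ (const refl) (const z∈R))
  ... | no  z∉R       | false = pad (mk⇔ (⊥-elim ∘ z∉R) λ ())
  ... | no  z∉R       | true  = insert z∉R
  ... | yes (i , z∈i) | false = delete z∈i

-- Rationals on a grid

-- grid d t is the rational t / (1 + d).
grid : ℕ → ℤ → ℚ
grid d t = fromℚᵘ (mkℚᵘ t d)

toℚᵘ-grid : ∀ d t → toℚᵘ (grid d t) ℚᵘ.≃ mkℚᵘ t d
toℚᵘ-grid d t = ℚ.toℚᵘ-fromℚᵘ (mkℚᵘ t d)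

grid-cross : ∀ d a e b → a * +[1+ e ] ≡ b * +[1+ d ] → grid d a ≡ grid e b
grid-cross d a e b eq = ℚ.fromℚᵘ-cong {mkℚᵘ a d} {mkℚᵘ b e} (*≡* eq)

grid-0 : ∀ d → grid d (+ 0) ≡ 0ℚ
grid-0 d = grid-cross d (+ 0) 0 (+ 0) refl

grid-+ : ∀ d a b → grid d a ℚ.+ grid d b ≡ grid d (a + b)
grid-+ d a b = ℚ.toℚᵘ-injective (ℚᵘ.≃-trans (ℚ.toℚᵘ-homo-+ (grid d a) (grid d b))
  (ℚᵘ.≃-trans (ℚᵘ.+-cong (toℚᵘ-grid d a) (toℚᵘ-grid d b))
  (ℚᵘ.≃-trans (*≡* (identity a b +[1+ d ])) (ℚᵘ.≃-sym (toℚᵘ-grid d (a + b))))))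
  where
  identity : ∀ a b e → (a * e + b * e) * e ≡ (a + b) * (e * e)
  identity = solve-∀

≡grid : ∀ p → p ≡ grid (ℚ.denominator-1 p) (↥ p)
≡grid p@record{} = sym (ℚ.fromℚᵘ-toℚᵘ p)

-- Chosen so that suc (d ⊛ e) reduces to suc d * suc e.
_⊛_ : ℕ → ℕ → ℕ
d ⊛ e = e ℕ.+ d ℕ.* suc e

grid-refineˡ : ∀ d e a → grid d a ≡ grid (d ⊛ e) (a * +[1+ e ])
grid-refineˡ d e a = grid-cross d a (d ⊛ e) (a * +[1+ e ]) (identity a +[1+ d ] +[1+ e ])
  where
  identity : ∀ a x y → a * (x * y) ≡ a * y * x
  identity = solve-∀

grid-refineʳ : ∀ d e a → grid e a ≡ grid (d ⊛ e) (a * +[1+ d ])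
grid-refineʳ d e a = grid-cross e a (d ⊛ e) (a * +[1+ d ]) (identity a +[1+ d ] +[1+ e ])
  where
  identity : ∀ a x y → a * (x * y) ≡ a * x * y
  identity = solve-∀

commonDenominator : ∀ {n} (w : Fin n → ℚ) → ∃₂ λ d (M : Fin n → ℤ) → ∀ u → w u ≡ grid d (M u)
commonDenominator {ℕ.zero} w = 0 , (λ ()) , (λ ())
commonDenominator {suc n} w with commonDenominator (w ∘ suc)
... | d , M , w∘suc≡ = r ⊛ d , M′ , w≡
  where
  r = ℚ.denominator-1 (w zero)
  M′ : Fin (suc n) → ℤ
  M′ = (↥ w zero * +[1+ d ]) ∷ (λ u → M u * +[1+ r ])
  w≡ : ∀ u → w u ≡ grid (r ⊛ d) (M′ u)
  w≡ zero    = trans (≡grid (w zero)) (grid-refineˡ r d (↥ w zero))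
  w≡ (suc u) = trans (w∘suc≡ u) (grid-refineʳ r d (M u))

≤⇔*≤*ᵘ : ∀ {p q x y} → toℚᵘ p ℚᵘ.≃ x → toℚᵘ q ℚᵘ.≃ y → p ℚ.≤ q ⇔ ↥ᵘ x * ↧ᵘ y ≤ ↥ᵘ y * ↧ᵘ x
≤⇔*≤*ᵘ p≃x q≃y = mk⇔
  (λ p≤q → ℚᵘ.drop-*≤* (ℚᵘ.≤-respˡ-≃ p≃x (ℚᵘ.≤-respʳ-≃ q≃y (ℚ.toℚᵘ-mono-≤ p≤q))))
  (λ le → ℚ.toℚᵘ-cancel-≤ (ℚᵘ.≤-respˡ-≃ (ℚᵘ.≃-sym p≃x) (ℚᵘ.≤-respʳ-≃ (ℚᵘ.≃-sym q≃y) (*≤* le))))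

≤⇔≤⇒<⇔< : ∀ {x y : ℚ} {i j} → x ℚ.≤ y ⇔ i ≤ j → y ℚ.< x ⇔ j < i
≤⇔≤⇒<⇔< x≤y⇔i≤j = mk⇔
  (λ y<x → ℤ.≰⇒> (λ i≤j → ℚ.<-irrefl refl (ℚ.<-≤-trans y<x (from x≤y⇔i≤j i≤j))))
  (λ j<i → ℚ.≰⇒> (ℤ.<⇒≱ j<i ∘ to x≤y⇔i≤j))

grid-≤ : ∀ d {a b} → grid d a ℚ.≤ grid d b ⇔ a ≤ b
grid-≤ d {a} {b} = mk⇔ (ℤ.*-cancelʳ-≤-pos a b +[1+ d ]) (ℤ.*-monoʳ-≤-nonNeg +[1+ d ])
                   ⇔-∘ ≤⇔*≤*ᵘ (toℚᵘ-grid d a) (toℚᵘ-grid d b)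

grid-< : ∀ d {a b} → grid d a ℚ.< grid d b ⇔ a < b
grid-< d = ≤⇔≤⇒<⇔< (grid-≤ d)

-- ⌊ p ⌋[ d ] and ⌈ p ⌉[ d ] are the floor and the ceiling of p · (1 + d).
⌊_⌋[_] ⌈_⌉[_] : ℚ → ℕ → ℤ
⌊ p ⌋[ d ] = (↥ p * +[1+ d ]) /ℕ ↧ₙ p
⌈ p ⌉[ d ] = ⌈ ↥ p * +[1+ d ] /ℕ ↧ₙ p ⌉

grid≤⇔≤⌊⌋ : ∀ p d t → grid d t ℚ.≤ p ⇔ t ≤ ⌊ p ⌋[ d ]
grid≤⇔≤⌊⌋ p@record{} d t = *-≤⇔≤-/ℕ t (↥ p * +[1+ d ]) (↧ₙ p) ⇔-∘ ≤⇔*≤*ᵘ (toℚᵘ-grid d t) ℚᵘ.≃-refl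

≤grid⇔⌈⌉≤ : ∀ p d t → p ℚ.≤ grid d t ⇔ ⌈ p ⌉[ d ] ≤ t
≤grid⇔⌈⌉≤ p@record{} d t = ≤-*⇔⌈/ℕ⌉-≤ t (↥ p * +[1+ d ]) (↧ₙ p) ⇔-∘ ≤⇔*≤*ᵘ ℚᵘ.≃-refl (toℚᵘ-grid d t)

<grid⇔⌊⌋< : ∀ p d t → p ℚ.< grid d t ⇔ ⌊ p ⌋[ d ] < t
<grid⇔⌊⌋< p d t = ≤⇔≤⇒<⇔< (grid≤⇔≤⌊⌋ p d t)

grid<⇔<⌈⌉ : ∀ p d t → grid d t ℚ.< p ⇔ t < ⌈ p ⌉[ d ]
grid<⇔<⌈⌉ p d t = ≤⇔≤⇒<⇔< (≤grid⇔⌈⌉≤ p d t)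

lowerBound upperBound : ℕ → Endpoint → Maybe ℤ
lowerBound d nothing            = nothing
lowerBound d (just (p , true))  = just ⌈ p ⌉[ d ]
lowerBound d (just (p , false)) = just (ℤ.suc ⌊ p ⌋[ d ])
upperBound d nothing            = nothing
upperBound d (just (p , true))  = just ⌊ p ⌋[ d ]
upperBound d (just (p , false)) = just (pred ⌈ p ⌉[ d ])

AboveLower-grid : ∀ d E t → AboveLower E (grid d t) ⇔ All (_≤ t) (lowerBound d E)
AboveLower-grid d nothing            t = mk⇔ (const nothing) (const tt)
AboveLower-grid d (just (p , true))  t = All.just-equivalence ⇔-∘ ≤grid⇔⌈⌉≤ p d t
AboveLower-grid d (just (p , false)) t =
  All.just-equivalence ⇔-∘ (mk⇔ ℤ.i<j⇒suc[i]≤j ℤ.suc[i]≤j⇒i<j ⇔-∘ <grid⇔⌊⌋< p d t)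

BelowUpper-grid : ∀ d E t → BelowUpper E (grid d t) ⇔ All (t ≤_) (upperBound d E)
BelowUpper-grid d nothing            t = mk⇔ (const nothing) (const tt)
BelowUpper-grid d (just (p , true))  t = All.just-equivalence ⇔-∘ grid≤⇔≤⌊⌋ p d t
BelowUpper-grid d (just (p , false)) t =
  All.just-equivalence ⇔-∘ (mk⇔ ℤ.i<j⇒i≤pred[j] ℤ.i≤pred[j]⇒i<j ⇔-∘ grid<⇔<⌈⌉ p d t)

roundᴿ : ℕ → Interval → Range
roundᴿ d I = lowerBound d (lower I) ⋯ upperBound d (upper I)

grid∈I⇔∈roundᴿ : ∀ d I t → grid d t ∈I I ⇔ t ∈ᴿ roundᴿ d I
grid∈I⇔∈roundᴿ d I t = AboveLower-grid d (lower I) t ×-⇔ BelowUpper-grid d (upper I) t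

toInterval : ℕ → Range → Interval
toInterval d (a ⋯ b) = interval (Maybe.map (λ a → grid d a , true) a) (Maybe.map (λ b → grid d b , true) b)

grid∈toInterval⇔ : ∀ d r t → grid d t ∈I toInterval d r ⇔ t ∈ᴿ r
grid∈toInterval⇔ d (a ⋯ b) t = lower-⇔ a ×-⇔ upper-⇔ b
  where
  lower-⇔ : ∀ a → AboveLower (Maybe.map (λ a → grid d a , true) a) (grid d t) ⇔ All (_≤ t) a
  lower-⇔ nothing  = mk⇔ (const nothing) (const tt)
  lower-⇔ (just a) = All.just-equivalence ⇔-∘ grid-≤ d
  upper-⇔ : ∀ b → BelowUpper (Maybe.map (λ b → grid d b , true) b) (grid d t) ⇔ All (t ≤_) b
  upper-⇔ nothing  = mk⇔ (const nothing) (const tt)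
  upper-⇔ (just b) = All.just-equivalence ⇔-∘ grid-≤ d

⌊⌋-∈ᴿ : ∀ d r {x} → x ∈I toInterval d r → ⌊ x ⌋[ d ] ∈ᴿ r
⌊⌋-∈ᴿ d (a ⋯ b) {x} (a≤x , x≤b) = lower-∈ a a≤x , upper-∈ b x≤b
  where
  lower-∈ : ∀ a → AboveLower (Maybe.map (λ a → grid d a , true) a) x → All (_≤ ⌊ x ⌋[ d ]) a
  lower-∈ nothing  _   = nothing
  lower-∈ (just a) a≤x = just (to (grid≤⇔≤⌊⌋ x d a) a≤x)
  upper-∈ : ∀ b → BelowUpper (Maybe.map (λ b → grid d b , true) b) x → All (⌊ x ⌋[ d ] ≤_) b
  upper-∈ nothing  _   = nothing
  upper-∈ (just b) x≤b = just (to (grid-≤ d) (ℚ.≤-trans (from (grid≤⇔≤⌊⌋ x d ⌊ x ⌋[ d ]) ℤ.≤-refl) x≤b))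

-- Integral representations

record IntegralStarPCG {n} (G : Graph n) (k : ℕ) : Set where
  field
    weight     : Fin n → ℤ
    ranges     : Fin k → Range
    weight-pos : ∀ u → + 0 < weight u
    disjoint   : Disjoint ranges
    adjacency  : ∀ u v → u ≢ v → adj G u v ≡ true ⇔ Covered ranges (weight u + weight v)

module _ {n : ℕ} {G : Graph n} {k : ℕ} where

  integral⇒starPCG : IntegralStarPCG G k → IsStarPCG G k
  integral⇒starPCG P = grid 0 ∘ weight , toInterval 0 ∘ ranges , positive , apart , adjacent
    where
    open IntegralStarPCG P

    positive : ∀ u → 0ℚ ℚ.< grid 0 (weight u)
    positive u = subst (ℚ._< grid 0 (weight u)) (grid-0 0) (from (grid-< 0) (weight-pos u))

    apart : ∀ i j → i ≢ j → ∀ x → ¬ (x ∈I toInterval 0 (ranges i) × x ∈I toInterval 0 (ranges j))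
    apart i j i≢j x (x∈i , x∈j) =
      disjoint i j i≢j ⌊ x ⌋[ 0 ] (⌊⌋-∈ᴿ 0 (ranges i) x∈i) (⌊⌋-∈ᴿ 0 (ranges j) x∈j)

    adjacent : ∀ u v → u ≢ v → adj G u v ≡ true ⇔
               ∃ λ i → (grid 0 (weight u) ℚ.+ grid 0 (weight v)) ∈I toInterval 0 (ranges i)
    adjacent u v u≢v = begin
      adj G u v ≡ true
        ≈⟨ adjacency u v u≢v ⟩
      Covered ranges (weight u + weight v)
        ≈⟨ congˡ {k = equivalence} (grid∈toInterval⇔ 0 _ _) ⟨
      (∃ λ i → grid 0 (weight u + weight v) ∈I toInterval 0 (ranges i))
        ≡⟨ cong (λ x → ∃ λ i → x ∈I toInterval 0 (ranges i)) (grid-+ 0 (weight u) (weight v)) ⟨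
      (∃ λ i → (grid 0 (weight u) ℚ.+ grid 0 (weight v)) ∈I toInterval 0 (ranges i)) ∎
      where open ⇔-Reasoning

  starPCG⇒integral : IsStarPCG G k → IntegralStarPCG G k
  starPCG⇒integral (w , I , w-pos , I-disjoint , w-adjacency) with commonDenominator w
  ... | d , M , w≡grid = record
    { weight     = M
    ; ranges     = roundᴿ d ∘ I
    ; weight-pos = positive
    ; disjoint   = apart
    ; adjacency  = adjacent
    }
    where
    positive : ∀ u → + 0 < M u
    positive u = to (grid-< d) (subst₂ ℚ._<_ (sym (grid-0 d)) (w≡grid u) (w-pos u))

    apart : Disjoint (roundᴿ d ∘ I)
    apart i j i≢j t t∈i t∈j = I-disjoint i j i≢j (grid d t)
      (from (grid∈I⇔∈roundᴿ d (I i) t) t∈i , from (grid∈I⇔∈roundᴿ d (I j) t) t∈j)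

    adjacent : ∀ u v → u ≢ v → adj G u v ≡ true ⇔ Covered (roundᴿ d ∘ I) (M u + M v)
    adjacent u v u≢v = begin
      adj G u v ≡ true                     ≈⟨ w-adjacency u v u≢v ⟩
      (∃ λ i → (w u ℚ.+ w v) ∈I I i)      ≡⟨ cong (λ x → ∃ λ i → x ∈I I i) w-sum ⟩
      (∃ λ i → grid d (M u + M v) ∈I I i) ≈⟨ congˡ {k = equivalence} (grid∈I⇔∈roundᴿ d _ _) ⟩
      Covered (roundᴿ d ∘ I) (M u + M v)  ∎
      where
      open ⇔-Reasoning
      w-sum : w u ℚ.+ w v ≡ grid d (M u + M v)
      w-sum = trans (cong₂ ℚ._+_ (w≡grid u) (w≡grid v)) (grid-+ d (M u) (M v))

-- Twins

≡true-injective : ∀ {a b} → (a ≡ true ⇔ b ≡ true) → a ≡ b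
≡true-injective {false} {false} _   = refl
≡true-injective {false} {true}  a⇔b = from a⇔b refl
≡true-injective {true}  {false} a⇔b = sym (to a⇔b refl)
≡true-injective {true}  {true}  _   = refl

record TwinClass {N} (G : Graph N) (S : Fin N → Set) (r : Fin N) (b : Bool) : Set where
  field
    outside : ∀ {y x} → S y → x ≢ y → x ≢ r → adj G y x ≡ adj G r x
    inside  : ∀ {y y′} → S y → S y′ → y ≢ y′ → adj G y y′ ≡ b

module _ {N : ℕ} {G : Graph N} {S : Fin N → Set} {r : Fin N} (r∈S : S r) where

  falseTwins⇒TwinClass : PairwiseOn S (FalseTwins G) → TwinClass G S r false
  falseTwins⇒TwinClass twins = record { outside = outside ; inside = inside }
    where
    outside : ∀ {y x} → S y → x ≢ y → x ≢ r → adj G y x ≡ adj G r x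
    outside {y} {x} y∈S _ _ with y Fin.≟ r
    ... | yes refl = refl
    ... | no y≢r   = twins y r y∈S r∈S y≢r x
    inside : ∀ {y y′} → S y → S y′ → y ≢ y′ → adj G y y′ ≡ false
    inside {y} {y′} y∈S y′∈S y≢y′ = trans (twins y y′ y∈S y′∈S y≢y′ y′) (irrefl G y′)

  trueTwins⇒TwinClass : PairwiseOn S (TrueTwins G) → TwinClass G S r true
  trueTwins⇒TwinClass twins = record { outside = outside ; inside = inside }
    where
    outside : ∀ {y x} → S y → x ≢ y → x ≢ r → adj G y x ≡ adj G r x
    outside {y} {x} y∈S x≢y x≢r with y Fin.≟ r
    ... | yes refl = refl
    ... | no y≢r   = ≡true-injective (mk⇔ (neighbour x≢r ∘ to y~r ∘ inj₂) (neighbour x≢y ∘ from y~r ∘ inj₂))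
      where
      y~r = twins y r y∈S r∈S y≢r x
      neighbour : ∀ {z} → x ≢ z → x ≡ z ⊎ adj G z x ≡ true → adj G z x ≡ true
      neighbour x≢z = fromInj₂ (⊥-elim ∘ x≢z)
    inside : ∀ {y y′} → S y → S y′ → y ≢ y′ → adj G y y′ ≡ true
    inside {y} {y′} y∈S y′∈S y≢y′ with to (twins y y′ y∈S y′∈S y≢y′ y) (inj₁ refl)
    ... | inj₁ y≡y′ = contradiction y≡y′ y≢y′
    ... | inj₂ y′~y = trans (Graph.sym G y y′) y′~y

  twinClass : PairwiseOn S (FalseTwins G) ⊎ PairwiseOn S (TrueTwins G) → ∃ (TwinClass G S r)
  twinClass (inj₁ false-twins) = false , falseTwins⇒TwinClass false-twins
  twinClass (inj₂ true-twins)  = true , trueTwins⇒TwinClass true-twins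

data Side {n m} (v : Fin n) : Fin (n ℕ.+ m) → Set where
  old : ∀ u → u ≢ v → Side v (u ↑ˡ m)
  new : ∀ {y} → InVX {n} {m} v y → Side v y

side : ∀ {n m} (v : Fin n) (y : Fin (n ℕ.+ m)) → Side v y
side {n} v y with splitAt n y in eq
... | inj₂ x = new (inj₂ (x , sym (Fin.splitAt⁻¹-↑ʳ eq)))
... | inj₁ u with u Fin.≟ v
...   | yes refl = new (inj₁ (sym (Fin.splitAt⁻¹-↑ˡ eq)))
...   | no u≢v   = subst (Side v) (Fin.splitAt⁻¹-↑ˡ eq) (old u u≢v)

module _ {n m k : ℕ} {G : Graph n} (P : IntegralStarPCG G k) (v : Fin n)
         {G′ : Graph (n ℕ.+ m)} (induced : InducedOnOld G′ G)
         {b : Bool} (twins : TwinClass G′ (InVX {n} {m} v) (v ↑ˡ m) b) where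

  open IntegralStarPCG P
  open TwinClass twins

  private
    codeOf : ∀ {y} → Side {n} {m} v y → ℤ
    codeOf (old u _) = + 3 * weight u
    codeOf (new _)   = + 3 * weight v + + 1

    code : Fin (n ℕ.+ m) → ℤ
    code y = codeOf (side {m = m} v y)

    code-pos : ∀ y → + 0 < code y
    code-pos y with side {m = m} v y
    ... | old u _ = ℤ.*-monoˡ-<-pos (+ 3) (weight-pos u)
    ... | new _   = ℤ.<-≤-trans (ℤ.*-monoˡ-<-pos (+ 3) (weight-pos v)) (ℤ.i≤i+j (+ 3 * weight v) (+ 1))

    inner-sum : ℤ
    inner-sum = + 3 * (weight v + weight v) + + 2

    open Toggled (toggle (Disjoint-triple disjoint) inner-sum b)
      renaming (ranges to ranges′; disjoint to disjoint′)

    ≢inner-sum : ∀ s {e} → e ℕ.≤ 1 → + 3 * s + + e ≢ inner-sum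
    ≢inner-sum s e≤1 = ℕ.<⇒≢ (ℕ.s≤s e≤1) ∘
      *-+-residue-injective 3 {s} {weight v + weight v} (ℕ.s≤s (ℕ.m≤n⇒m≤1+n e≤1)) ℕ.≤-refl

    adjacency-via : ∀ {y y′ u u′ c} e → e ℕ.≤ 1 → u ≢ u′ → adj G′ y y′ ≡ adj G u u′ →
                    c ≡ + 3 * (weight u + weight u′) + + e →
                    adj G′ y y′ ≡ true ⇔ Covered ranges′ c
    adjacency-via {y} {y′} {u} {u′} {c} e e≤1 u≢u′ adj≡ c≡ = begin
      adj G′ y y′ ≡ true                         ≡⟨ cong (_≡ true) adj≡ ⟩
      adj G u u′ ≡ true                          ≈⟨ adjacency u u′ u≢u′ ⟩
      Covered ranges s                           ≈⟨ Covered-triple e≤1 ⟨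
      Covered (triple ∘ ranges) (+ 3 * s + + e)  ≈⟨ elsewhere (≢inner-sum s e≤1) ⟨
      Covered ranges′ (+ 3 * s + + e)            ≡⟨ cong (Covered ranges′) c≡ ⟨
      Covered ranges′ c                          ∎
      where
      open ⇔-Reasoning
      s = weight u + weight u′

    new-old : ∀ {y u} → InVX v y → u ≢ v → u ↑ˡ m ≢ y → adj G′ y (u ↑ˡ m) ≡ adj G v u
    new-old {y} {u} y∈S u≢v u≢y = trans (outside y∈S u≢y (u≢v ∘ Fin.↑ˡ-injective m u v)) (induced v u)

    old+old : ∀ a a′ → + 3 * a + + 3 * a′ ≡ + 3 * (a + a′) + + 0
    old+old = solve-∀
    old+new : ∀ a a′ → + 3 * a + (+ 3 * a′ + + 1) ≡ + 3 * (a′ + a) + + 1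
    old+new = solve-∀
    new+old : ∀ a a′ → (+ 3 * a + + 1) + + 3 * a′ ≡ + 3 * (a + a′) + + 1
    new+old = solve-∀
    new+new : ∀ a → (+ 3 * a + + 1) + (+ 3 * a + + 1) ≡ + 3 * (a + a) + + 2
    new+new = solve-∀

    adjacency′ : ∀ y y′ → y ≢ y′ → adj G′ y y′ ≡ true ⇔ Covered ranges′ (code y + code y′)
    adjacency′ y y′ y≢y′ with side {m = m} v y | side {m = m} v y′
    ... | old u _ | old u′ _ =
      adjacency-via 0 ℕ.z≤n (y≢y′ ∘ cong (_↑ˡ m)) (induced u u′) (old+old (weight u) (weight u′))
    ... | old u u≢v | new y′∈S =
      adjacency-via 1 ℕ.≤-refl (u≢v ∘ sym) (trans (Graph.sym G′ _ _) (new-old y′∈S u≢v y≢y′))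
                    (old+new (weight u) (weight v))
    ... | new y∈S | old u′ u′≢v =
      adjacency-via 1 ℕ.≤-refl (u′≢v ∘ sym) (new-old y∈S u′≢v (y≢y′ ∘ sym)) (new+old (weight v) (weight u′))
    ... | new y∈S | new y′∈S = begin
      adj G′ y y′ ≡ true                                  ≡⟨ cong (_≡ true) (inside y∈S y′∈S y≢y′) ⟩
      b ≡ true                                            ≈⟨ at ⟨
      Covered ranges′ inner-sum                           ≡⟨ cong (Covered ranges′) (new+new (weight v)) ⟨
      Covered ranges′ ((+ 3 * weight v + + 1) + (+ 3 * weight v + + 1)) ∎
      where open ⇔-Reasoning

  twinExtension : IntegralStarPCG G′ (suc k)
  twinExtension = record
    { weight     = code
    ; ranges     = ranges′
    ; weight-pos = code-pos
    ; disjoint   = disjoint′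
    ; adjacency  = adjacency′
    }

theorem5 : (n m k : ℕ) (G : Graph n) → StarNumberIs G k → (v : Fin n) →
    (G' : Graph (n Data.Nat.+ m)) → InducedOnOld G' G →
    (PairwiseOn (InVX {n} {m} v) (FalseTwins G') ⊎ PairwiseOn (InVX {n} {m} v) (TrueTwins G')) →
    StarNumberAtMost G' (suc k)
theorem5 n m k G (_ , pcg , _) v G' induced twins =
  suc k , ℕ.s≤s ℕ.z≤n , ℕ.≤-refl , integral⇒starPCG extended
  where
  extended : IntegralStarPCG G' (suc k)
  extended = twinExtension (starPCG⇒integral {G = G} pcg) v {G′ = G'} induced
                           (proj₂ (twinClass (inj₁ refl) twins))
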